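{- For all strings $x,y$, letting $j = |x|$ and $n = |xy|$, \[ j - K(x|j) \le n - K(xy|j,n) + O(1) \,. \]
   Context: $K(\cdot|\cdot)$ denotes conditional prefix Kolmogorov complexity; $xy$ is the concatenation of $x$ and $y$ and $|\cdot|$ denotes length. -}

module Defs where

open import Data.Bool using (Bool; true; false; if_then_else_)
open import Data.Nat using (ℕ; _+_; _≤_; _<_)
open import Data.Fin using (Fin)
open import Data.List using (List; []; _∷_; _++_; length; replicate)
open import Data.Vec using (Vec; []; _∷_; lookup)
open import Data.Product using (Σ; ∃; ∃₂; _×_)
open import Relation.Binary.PropositionalEquality using (_≡_)

Word : Set
Word = List Bool

unary : ℕ → Word
unary i = replicate i true

-- A concrete Turing-complete model of computation: partial recursive
-- functions on binary words (word recursion + unbounded minimisation).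
-- Code k = programs taking k word arguments.

data Code : ℕ → Set where
  nil  : ∀ {k} → Code k
  proj : ∀ {k} → Fin k → Code k
  cons : Bool → Code 1
  comp : ∀ {k m} → Code m → Vec (Code k) m → Code k
  rec  : ∀ {k} → Code k → Code (2 + k) → Code (2 + k) → Code (1 + k)
  mu   : ∀ {k} → Code (1 + k) → Code k

infix 4 _[_]⇓_ _[_]⇓*_
data _[_]⇓_ : ∀ {k} → Code k → Vec Word k → Word → Set
data _[_]⇓*_ : ∀ {k m} → Vec (Code k) m → Vec Word k → Vec Word m → Set

data _[_]⇓_ where
  nil⇓  : ∀ {k} {xs : Vec Word k} → nil [ xs ]⇓ []
  proj⇓ : ∀ {k} {xs : Vec Word k} (i : Fin k) → proj i [ xs ]⇓ lookup xs i
  cons⇓ : ∀ (b : Bool) (w : Word) → cons b [ w ∷ [] ]⇓ (b ∷ w)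
  comp⇓ : ∀ {k m} {f : Code m} {gs : Vec (Code k) m} {xs ys z} →
          gs [ xs ]⇓* ys → f [ ys ]⇓ z → comp f gs [ xs ]⇓ z
  rec[]⇓ : ∀ {k} {g : Code k} {h₀ h₁ xs z} →
           g [ xs ]⇓ z → rec g h₀ h₁ [ [] ∷ xs ]⇓ z
  rec∷⇓ : ∀ {k} {g : Code k} {h₀ h₁ xs w z z'} (b : Bool) →
          rec g h₀ h₁ [ w ∷ xs ]⇓ z →
          (if b then h₁ else h₀) [ w ∷ z ∷ xs ]⇓ z' →
          rec g h₀ h₁ [ (b ∷ w) ∷ xs ]⇓ z'
  mu⇓ : ∀ {k} {f : Code (1 + k)} {xs} (i : ℕ) →
        f [ unary i ∷ xs ]⇓ [] →
        (∀ i′ → i′ < i → ∃₂ λ b v → f [ unary i′ ∷ xs ]⇓ (b ∷ v)) →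
        mu f [ xs ]⇓ unary i

data _[_]⇓*_ where
  []⇓  : ∀ {k} {xs : Vec Word k} → [] [ xs ]⇓* []
  _∷⇓_ : ∀ {k m} {g : Code k} {gs : Vec (Code k) m} {xs y ys} →
         g [ xs ]⇓ y → gs [ xs ]⇓* ys → (g ∷ gs) [ xs ]⇓* (y ∷ ys)

-- Conditional prefix machines: a machine is a code of arity 2,
-- M [ p ∷ c ∷ [] ]⇓ x  : on program p with conditional input c, output x.

Runs : Code 2 → Word → Word → Word → Set
Runs M p c x = M [ p ∷ c ∷ [] ]⇓ x

PrefixMachine : Code 2 → Set
PrefixMachine M = ∀ c p q u v → Runs M p c u → Runs M (p ++ q) c v → q ≡ []

OptimalPrefixMachine : Code 2 → Set
OptimalPrefixMachine U =
  PrefixMachine U ×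
  (∀ M → PrefixMachine M → ∃ λ d → ∀ p c x → Runs M p c x →
     ∃ λ p′ → Runs U p′ c x × length p′ ≤ length p + d)

-- Encoding of a tuple of naturals as a conditional-input word:
-- (n₁,…,n_r) ↦ 1^{n₁} 0 1^{n₂} 0 … 1^{n_r} 0
⟪_⟫ : List ℕ → Word
⟪ [] ⟫ = []
⟪ n ∷ ns ⟫ = unary n ++ (false ∷ ⟪ ns ⟫)

IsK : Code 2 → Word → Word → ℕ → Set
IsK U x c k = (∃ λ p → Runs U p c x × length p ≡ k)
            × (∀ p → Runs U p c x → k ≤ length p)

module Submission where

-- An auxiliary prefix
-- machine M = auxMachine U, on conditional input ⟪ j ∷ n ∷ [] ⟫ and program
-- y ʳ++ p (the reversal of y followed by p), reads the first n ∸ j bits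
-- as the suffix y and then runs U on the rest p with conditional ⟪ j ⟫:
--
--     U(p | j) = x   implies   M(y ʳ++ p | j , |x y|) = x y .
--
-- M halts only when its program is at least n ∸ j bits long, so that
-- extensions of halting programs are halting U-programs after the cut:
-- M is prefix-free because U is.
-- Optimality of U against M gives a constant d with
-- K(x y | j , n) ≤ |y| + K(x | j) + d, which rearranges to the claim.

open import Defs
open import Data.Bool using (Bool; true; false)
open import Data.Nat as ℕ using (ℕ; zero; suc; _∸_; z≤n; s≤s)
import Data.Nat.Properties as ℕP
open import Data.Fin using (Fin; zero; suc)
open import Data.List using (List; []; _∷_; _++_; _ʳ++_; drop; length; reverse)
import Data.List.Properties as LP
open import Data.Vec using (Vec; []; _∷_)
open import Data.Product using (∃; _×_; _,_)
open import Data.Empty using (⊥; ⊥-elim)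
open import Relation.Binary.PropositionalEquality
open import Relation.Binary.Definitions using (tri<; tri≈; tri>)
import Data.Integer.Properties as ℤP
open import Data.Integer.Tactic.RingSolver using (solve-∀)
open import Data.Integer using (+_; _-_; _+_; _≤_; +≤+)

-- Determinism: every code computes a partial function.  For `mu`, two
-- different witnesses are impossible because the smaller one would be
-- among the non-ε values required below the larger one.

det : ∀ {k} {c : Code k} {xs a b} → c [ xs ]⇓ a → c [ xs ]⇓ b → a ≡ b
det* : ∀ {k m} {gs : Vec (Code k) m} {xs as bs} →
       gs [ xs ]⇓* as → gs [ xs ]⇓* bs → as ≡ bs
det nil⇓ nil⇓ = refl
det (proj⇓ i) (proj⇓ .i) = refl
det (cons⇓ b w) (cons⇓ .b .w) = refl
det (comp⇓ ds d) (comp⇓ es e) with det* ds es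
... | refl = det d e
det (rec[]⇓ d) (rec[]⇓ e) = det d e
det (rec∷⇓ b d h) (rec∷⇓ .b e h′) with det d e
... | refl = det h h′
det (mu⇓ i d below) (mu⇓ i′ e below′) with ℕP.<-cmp i i′
... | tri≈ _ refl _ = refl
... | tri< i<i′ _ _ with below′ i i<i′
...   | _ , _ , e′ with det d e′
...     | ()
det (mu⇓ i d below) (mu⇓ i′ e below′) | tri> _ _ i′<i with below i′ i′<i
...   | _ , _ , d′ with det d′ e
...     | ()
det* []⇓ []⇓ = refl
det* (d ∷⇓ ds) (e ∷⇓ es) with det d e | det* ds es
... | refl | refl = refl

rec-uniform∷⇓ : ∀ {k} {g : Code k} {h : Code (2 ℕ.+ k)} {xs w z z′} (b : Bool) →
                rec g h h [ w ∷ xs ]⇓ z → h [ w ∷ z ∷ xs ]⇓ z′ →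
                rec g h h [ (b ∷ w) ∷ xs ]⇓ z′
rec-uniform∷⇓ true  = rec∷⇓ true
rec-uniform∷⇓ false = rec∷⇓ false

drop-++ : ∀ {A : Set} n (xs ys : List A) → n ℕ.≤ length xs →
          drop n (xs ++ ys) ≡ drop n xs ++ ys
drop-++ zero    xs       ys _         = refl
drop-++ (suc n) (x ∷ xs) ys (s≤s n≤∣xs∣) = drop-++ n xs ys n≤∣xs∣

drop-length-++ : ∀ {A : Set} (xs ys : List A) → drop (length xs) (xs ++ ys) ≡ ys
drop-length-++ []       ys = refl
drop-length-++ (x ∷ xs) ys = drop-length-++ xs ys

drop-ʳ++ : ∀ {A : Set} n (xs ys : List A) → n ≡ length xs → drop n (xs ʳ++ ys) ≡ ys
drop-ʳ++ n xs ys refl = begin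
  drop (length xs) (xs ʳ++ ys)           ≡⟨ cong (drop (length xs)) (LP.ʳ++-defn xs) ⟩
  drop (length xs) (reverse xs ++ ys)    ≡⟨ cong (λ m → drop m (reverse xs ++ ys)) (sym (LP.length-reverse xs)) ⟩
  drop (length (reverse xs)) (reverse xs ++ ys) ≡⟨ drop-length-++ (reverse xs) ys ⟩
  ys                                     ∎
  where open ≡-Reasoning

arg₀ : ∀ {k} → Fin (1 ℕ.+ k)
arg₀ = zero

arg₁ : ∀ {k} → Fin (2 ℕ.+ k)
arg₁ = suc zero

arg₂ : ∀ {k} → Fin (3 ℕ.+ k)
arg₂ = suc (suc zero)

tailC : Code 1
tailC = rec nil (proj arg₀) (proj arg₀)

tail⇓ : ∀ w → tailC [ w ∷ [] ]⇓ drop 1 w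
tail⇓ []      = rec[]⇓ nil⇓
tail⇓ (b ∷ w) = rec-uniform∷⇓ b (tail⇓ w) (proj⇓ arg₀)

dropC : Code 2
dropC = rec (proj arg₀) (comp tailC (proj arg₁ ∷ [])) (comp tailC (proj arg₁ ∷ []))

drop⇓ : ∀ k p → dropC [ k ∷ p ∷ [] ]⇓ drop (length k) p
drop⇓ []      p = rec[]⇓ (proj⇓ arg₀)
drop⇓ (b ∷ k) p =
  rec-uniform∷⇓ b (drop⇓ k p)
    (subst (λ r → comp tailC (proj arg₁ ∷ []) [ k ∷ drop (length k) p ∷ p ∷ [] ]⇓ r)
           (trans (LP.drop-drop (length k) 1 p) (cong (λ m → drop m p) (ℕP.+-comm (length k) 1)))
           (comp⇓ (proj⇓ arg₁ ∷⇓ []⇓) (tail⇓ (drop (length k) p))))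

appendC : Code 2
appendC = rec (proj arg₀) (comp (cons false) (proj arg₁ ∷ [])) (comp (cons true) (proj arg₁ ∷ []))

append⇓ : ∀ x y → appendC [ x ∷ y ∷ [] ]⇓ (x ++ y)
append⇓ []          y = rec[]⇓ (proj⇓ arg₀)
append⇓ (true ∷ x)  y = rec∷⇓ true  (append⇓ x y) (comp⇓ (proj⇓ arg₁ ∷⇓ []⇓) (cons⇓ true _))
append⇓ (false ∷ x) y = rec∷⇓ false (append⇓ x y) (comp⇓ (proj⇓ arg₁ ∷⇓ []⇓) (cons⇓ false _))

firstField : Word → Word
firstField []          = []
firstField (true ∷ w)  = true ∷ firstField w
firstField (false ∷ w) = false ∷ []

otherFields : Word → Word
otherFields []          = []
otherFields (true ∷ w)  = otherFields w
otherFields (false ∷ w) = w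

firstField-⟪⟫ : ∀ j ns → firstField ⟪ j ∷ ns ⟫ ≡ ⟪ j ∷ [] ⟫
firstField-⟪⟫ zero    ns = refl
firstField-⟪⟫ (suc j) ns = cong (true ∷_) (firstField-⟪⟫ j ns)

otherFields-⟪⟫ : ∀ j ns → otherFields ⟪ j ∷ ns ⟫ ≡ ⟪ ns ⟫
otherFields-⟪⟫ zero    ns = refl
otherFields-⟪⟫ (suc j) ns = otherFields-⟪⟫ j ns

length-⟪⟫ : ∀ n → length ⟪ n ∷ [] ⟫ ≡ suc n
length-⟪⟫ zero    = refl
length-⟪⟫ (suc n) = cong suc (length-⟪⟫ n)

firstFieldC : Code 1
firstFieldC = rec nil (comp (cons false) (nil ∷ [])) (comp (cons true) (proj arg₁ ∷ []))

firstField⇓ : ∀ w → firstFieldC [ w ∷ [] ]⇓ firstField w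
firstField⇓ []          = rec[]⇓ nil⇓
firstField⇓ (true ∷ w)  = rec∷⇓ true  (firstField⇓ w) (comp⇓ (proj⇓ arg₁ ∷⇓ []⇓) (cons⇓ true _))
firstField⇓ (false ∷ w) = rec∷⇓ false (firstField⇓ w) (comp⇓ (nil⇓ ∷⇓ []⇓) (cons⇓ false _))

otherFieldsC : Code 1
otherFieldsC = rec nil (proj arg₀) (proj arg₁)

otherFields⇓ : ∀ w → otherFieldsC [ w ∷ [] ]⇓ otherFields w
otherFields⇓ []          = rec[]⇓ nil⇓
otherFields⇓ (true ∷ w)  = rec∷⇓ true  (otherFields⇓ w) (proj⇓ arg₁)
otherFields⇓ (false ∷ w) = rec∷⇓ false (otherFields⇓ w) (proj⇓ arg₀)

-- The key of a conditional input: on ⟪ j ∷ n ∷ [] ⟫ a word of length n ∸ j,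
-- telling M how many program bits encode the suffix y.
keyC : Code 1
keyC = comp dropC (firstFieldC ∷ otherFieldsC ∷ [])

key⇓ : ∀ j n → ∃ λ key → (keyC [ ⟪ j ∷ n ∷ [] ⟫ ∷ [] ]⇓ key) × (length key ≡ n ∸ j)
key⇓ j n = drop (length (firstField c)) (otherFields c)
         , comp⇓ (firstField⇓ c ∷⇓ (otherFields⇓ c ∷⇓ []⇓)) (drop⇓ _ _)
         , length-key
  where
  c = ⟪ j ∷ n ∷ [] ⟫
  length-key : length (drop (length (firstField c)) (otherFields c)) ≡ n ∸ j
  length-key rewrite firstField-⟪⟫ j (n ∷ []) | otherFields-⟪⟫ j (n ∷ [])
                   | LP.length-drop (length ⟪ j ∷ [] ⟫) ⟪ n ∷ [] ⟫
                   | length-⟪⟫ j | length-⟪⟫ n = refl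

-- A guard that halts (with output ε) exactly on nonempty words, built by
-- minimisation over the test  ε ↦ 1, nonempty ↦ ε.
isEmpty : Word → Word
isEmpty []      = true ∷ []
isEmpty (_ ∷ _) = []

isEmptyC : Code 1
isEmptyC = rec (comp (cons true) (nil ∷ [])) nil nil

isEmpty⇓ : ∀ w → isEmptyC [ w ∷ [] ]⇓ isEmpty w
isEmpty⇓ []      = rec[]⇓ (comp⇓ (nil⇓ ∷⇓ []⇓) (cons⇓ true []))
isEmpty⇓ (b ∷ w) = rec-uniform∷⇓ b (isEmpty⇓ w) nil⇓

-- Searches for an i with isEmpty w = ε: succeeds at i = 0 or never.
guardC : Code 1
guardC = mu (comp isEmptyC (proj arg₁ ∷ []))

guard⇓ : ∀ b v → guardC [ (b ∷ v) ∷ [] ]⇓ []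
guard⇓ b v = mu⇓ 0 (comp⇓ (proj⇓ arg₁ ∷⇓ []⇓) (isEmpty⇓ (b ∷ v))) (λ _ ())

guard-diverges-on-ε : ∀ {z} → guardC [ [] ∷ [] ]⇓ z → ⊥
guard-diverges-on-ε (mu⇓ _ (comp⇓ (proj⇓ _ ∷⇓ []⇓) (rec[]⇓ (comp⇓ (nil⇓ ∷⇓ []⇓) ()))) _)

-- readC (k , P) outputs P[|k|-1] ∷ … ∷ P[0], and halts only if |k| ≤ |P|:
-- the step for k = b ∷ w conses the symbol at position |w| of P onto the
-- result for w, guarded so that it diverges when that position is absent.

-- (q , z , g) ↦ (head q) ∷ z;  g is the guard's output, demanded only
-- so that the step diverges when q is empty.
consHeadC : Code 3
consHeadC = rec nil (comp (cons false) (proj arg₂ ∷ [])) (comp (cons true) (proj arg₂ ∷ []))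

consHead : Word → Word → Word
consHead []      z = []
consHead (a ∷ _) z = a ∷ z

consHead⇓ : ∀ q z g → consHeadC [ q ∷ z ∷ g ∷ [] ]⇓ consHead q z
consHead⇓ []          z g = rec[]⇓ nil⇓
consHead⇓ (true ∷ q)  z g = rec∷⇓ true  (consHead⇓ q z g) (comp⇓ (proj⇓ arg₂ ∷⇓ []⇓) (cons⇓ true z))
consHead⇓ (false ∷ q) z g = rec∷⇓ false (consHead⇓ q z g) (comp⇓ (proj⇓ arg₂ ∷⇓ []⇓) (cons⇓ false z))

dropAtC : Code 3
dropAtC = comp dropC (proj arg₀ ∷ proj arg₂ ∷ [])

dropAt⇓ : ∀ w z P → dropAtC [ w ∷ z ∷ P ∷ [] ]⇓ drop (length w) P
dropAt⇓ w z P = comp⇓ (proj⇓ arg₀ ∷⇓ (proj⇓ arg₂ ∷⇓ []⇓)) (drop⇓ w P)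

readStepC : Code 3
readStepC = comp consHeadC (dropAtC ∷ proj arg₁ ∷ comp guardC (dropAtC ∷ []) ∷ [])

readC : Code 2
readC = rec nil readStepC readStepC

readStep⇓ : ∀ w z P {a v} → drop (length w) P ≡ a ∷ v → readStepC [ w ∷ z ∷ P ∷ [] ]⇓ (a ∷ z)
readStep⇓ w z P {a} {v} eq =
  comp⇓ (at ∷⇓ (proj⇓ arg₁ ∷⇓ (comp⇓ (at ∷⇓ []⇓) (guard⇓ a v) ∷⇓ []⇓))) (consHead⇓ (a ∷ v) z [])
  where
  at : dropAtC [ w ∷ z ∷ P ∷ [] ]⇓ (a ∷ v)
  at = subst (dropAtC [ w ∷ z ∷ P ∷ [] ]⇓_) eq (dropAt⇓ w z P)

readStep-fits : ∀ {w z P r} → readStepC [ w ∷ z ∷ P ∷ [] ]⇓ r → length w ℕ.< length P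
readStep-fits {w} {z} {P} (comp⇓ (_ ∷⇓ (_ ∷⇓ (comp⇓ (at ∷⇓ []⇓) g ∷⇓ []⇓))) _)
  with drop (length w) P | LP.length-drop (length w) P | det at (dropAt⇓ w z P)
... | []    | _   | refl = ⊥-elim (guard-diverges-on-ε g)
... | _ ∷ _ | len | refl = ℕP.m∸n≢0⇒n<m (λ eq → ℕP.1+n≢0 (trans len eq))

read⇓ : ∀ k y p → length k ≡ length y → readC [ k ∷ (y ʳ++ p) ∷ [] ]⇓ y
read⇓ []      []      p _   = rec[]⇓ nil⇓
read⇓ (b ∷ k) (a ∷ y) p len =
  rec-uniform∷⇓ b (read⇓ k y (a ∷ p) |k|≡|y|)
    (readStep⇓ k y (y ʳ++ (a ∷ p)) (drop-ʳ++ (length k) y (a ∷ p) |k|≡|y|))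
  where |k|≡|y| = ℕP.suc-injective len

read-fits : ∀ {k P z} → readC [ k ∷ P ∷ [] ]⇓ z → length k ℕ.≤ length P
read-fits (rec[]⇓ _)          = z≤n
read-fits (rec∷⇓ true  _ step) = readStep-fits step
read-fits (rec∷⇓ false _ step) = readStep-fits step

-- The auxiliary machine.  On program P and conditional input c:
--   key ← keyC c;   x ← U (drop |key| P | firstField c);
--   y ← readC (key , P);   output x ++ y.

keyOfCondC : Code 2
keyOfCondC = comp keyC (proj arg₁ ∷ [])

auxMachine : Code 2 → Code 2
auxMachine U =
  comp appendC
    ( comp U (comp dropC (keyOfCondC ∷ proj arg₀ ∷ []) ∷ comp firstFieldC (proj arg₁ ∷ []) ∷ [])
    ∷ comp readC (keyOfCondC ∷ proj arg₀ ∷ [])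
    ∷ [])

-- Forward run: the suffix y costs exactly |y| extra program bits.
auxMachine-runs : ∀ U p x y → Runs U p ⟪ length x ∷ [] ⟫ x →
                  Runs (auxMachine U) (y ʳ++ p) ⟪ length x ∷ length (x ++ y) ∷ [] ⟫ (x ++ y)
auxMachine-runs U p x y run with key⇓ (length x) (length (x ++ y))
... | key , key-run , key-len =
  comp⇓ ( comp⇓ ( comp⇓ (key-at ∷⇓ (proj⇓ arg₀ ∷⇓ []⇓)) dropped
                ∷⇓ (comp⇓ (proj⇓ arg₁ ∷⇓ []⇓) (firstField⇓ c) ∷⇓ []⇓))
                run-on-firstField
        ∷⇓ (comp⇓ (key-at ∷⇓ (proj⇓ arg₀ ∷⇓ []⇓)) (read⇓ key y p |key|≡|y|) ∷⇓ []⇓))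
        (append⇓ x y)
  where
  c = ⟪ length x ∷ length (x ++ y) ∷ [] ⟫
  |key|≡|y| : length key ≡ length y
  |key|≡|y| = trans key-len (trans (cong (_∸ length x) (LP.length-++ x)) (ℕP.m+n∸m≡n (length x) (length y)))
  key-at : keyOfCondC [ (y ʳ++ p) ∷ c ∷ [] ]⇓ key
  key-at = comp⇓ (proj⇓ arg₁ ∷⇓ []⇓) key-run
  dropped : dropC [ key ∷ (y ʳ++ p) ∷ [] ]⇓ p
  dropped = subst (dropC [ key ∷ (y ʳ++ p) ∷ [] ]⇓_) (drop-ʳ++ (length key) y p |key|≡|y|) (drop⇓ key (y ʳ++ p))
  run-on-firstField : Runs U p (firstField c) x
  run-on-firstField = subst (λ f → Runs U p f x) (sym (firstField-⟪⟫ (length x) (length (x ++ y) ∷ []))) run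

record AuxRun (U : Code 2) (P c : Word) : Set where
  field
    key       : Word
    key-run   : keyC [ c ∷ [] ]⇓ key
    inner-out : Word
    inner-run : Runs U (drop (length key) P) (firstField c) inner-out
    key-fits  : length key ℕ.≤ length P

auxMachine-inversion : ∀ {U P c z} → Runs (auxMachine U) P c z → AuxRun U P c
auxMachine-inversion {P = P} {c}
  (comp⇓ ( comp⇓ ( comp⇓ (comp⇓ (proj⇓ _ ∷⇓ []⇓) key-run ∷⇓ (proj⇓ _ ∷⇓ []⇓)) drop-run
                 ∷⇓ (comp⇓ (proj⇓ _ ∷⇓ []⇓) field-run ∷⇓ []⇓))
                 inner
         ∷⇓ (comp⇓ (comp⇓ (proj⇓ _ ∷⇓ []⇓) key-run′ ∷⇓ (proj⇓ _ ∷⇓ []⇓)) read-run ∷⇓ []⇓))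
         _)
  with det drop-run (drop⇓ _ P) | det field-run (firstField⇓ c) | det key-run′ key-run
... | refl | refl | refl = record
  { key = _ ; key-run = key-run ; inner-out = _ ; inner-run = inner ; key-fits = read-fits read-run }

-- Prefix-freeness is inherited from U: two halting programs p and p ++ q
-- use the same key, and their parts after the key are p′ and p′ ++ q.
auxMachine-prefix : ∀ U → PrefixMachine U → PrefixMachine (auxMachine U)
auxMachine-prefix U prefixU c p q _ _ run run′
  with auxMachine-inversion run | auxMachine-inversion run′
... | r | r′ with det (AuxRun.key-run r) (AuxRun.key-run r′)
... | refl =
  prefixU (firstField c) (drop ∣key∣ p) q _ _ (AuxRun.inner-run r)
    (subst (λ P → Runs U P (firstField c) (AuxRun.inner-out r′))
           (drop-++ ∣key∣ p q (AuxRun.key-fits r)) (AuxRun.inner-run r′))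
  where ∣key∣ = length (AuxRun.key r)

rearrange : ∀ {a b n c e d} → n ≡ a ℕ.+ b → c ℕ.≤ b ℕ.+ e ℕ.+ d →
            + a - + e ≤ (+ n - + c) + + d
rearrange {a} {b} {n} {c} {e} {d} refl c≤ = begin
  + a - + e                                ≡⟨ shift (+ a) (+ b) (+ e) (+ d) ⟩
  (+ a + + b - (+ b + + e + + d)) + + d    ≤⟨ ℤP.+-monoˡ-≤ (+ d) (ℤP.+-monoʳ-≤ (+ a + + b) (ℤP.neg-mono-≤ c≤ℤ)) ⟩
  (+ a + + b - + c) + + d                  ≡⟨ cong (λ t → (t - + c) + + d) (sym (ℤP.pos-+ a b)) ⟩
  (+ (a ℕ.+ b) - + c) + + d                ∎
  where
  open ℤP.≤-Reasoning
  shift : ∀ A B E D → A - E ≡ (A + B - (B + E + D)) + D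
  shift = solve-∀
  c≤ℤ : + c ≤ + b + + e + + d
  c≤ℤ = subst (+ c ≤_) (trans (ℤP.pos-+ (b ℕ.+ e) d) (cong (_+ + d) (ℤP.pos-+ b e))) (+≤+ c≤)

-- The theorem: d is the simulation constant of U for the auxiliary machine.

lemma3 : (U : Code 2) → OptimalPrefixMachine U →
         ∃ λ (d : ℕ) → ∀ (x y : Word) (kx kxy : ℕ) →
           IsK U x ⟪ length x ∷ [] ⟫ kx →
           IsK U (x ++ y) ⟪ length x ∷ length (x ++ y) ∷ [] ⟫ kxy →
           (+ length x) - (+ kx) ≤ ((+ length (x ++ y)) - (+ kxy)) + (+ d)
lemma3 U (prefixU , optimal) with optimal (auxMachine U) (auxMachine-prefix U prefixU)
... | d , simulate = d , bound
  where
  bound : ∀ (x y : Word) (kx kxy : ℕ) →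
          IsK U x ⟪ length x ∷ [] ⟫ kx →
          IsK U (x ++ y) ⟪ length x ∷ length (x ++ y) ∷ [] ⟫ kxy →
          (+ length x) - (+ kx) ≤ ((+ length (x ++ y)) - (+ kxy)) + (+ d)
  bound x y kx kxy ((p , run , |p|≡kx) , _) (_ , kxy-minimal)
    with simulate (y ʳ++ p) _ (x ++ y) (auxMachine-runs U p x y run)
  ... | p′ , run′ , |p′|≤ = rearrange {a = length x} {e = kx} (LP.length-++ x) (begin
    kxy                          ≤⟨ kxy-minimal p′ run′ ⟩
    length p′                    ≤⟨ |p′|≤ ⟩
    length (y ʳ++ p) ℕ.+ d       ≡⟨ cong (ℕ._+ d) (trans (LP.length-ʳ++ y) (cong (length y ℕ.+_) |p|≡kx)) ⟩
    length y ℕ.+ kx ℕ.+ d        ∎)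
    where open ℕP.≤-Reasoning
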